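{- Any gluing-parallel iposet $P$ has a decomposition $P=S\ast W\ast T$ (up to isomorphism) into a starter $S$, a Winkowski iposet $W$ and a terminator $T$, all three of which are gluing-parallel.
   Context: A poset is a finite set with an irreflexive transitive relation $<$; $P^{\min}$, $P^{\max}$ are its minimal and maximal elements. $[n]=\{1,\dots,n\}$, $[0]=\emptyset$. An iposet $(s,P,t):n\to m$ is a poset $P$ with injective maps $s:[n]\to P$, $t:[m]\to P$, $s([n])\subseteq P^{\min}$, $t([m])\subseteq P^{\max}$. Isomorphism of iposets: poset isomorphism commuting with source and target maps. Parallel composition $P_1\otimes P_2:n_1+n_2\to m_1+m_2$ of $(s_1,P_1,t_1):n_1\to m_1$ and $(s_2,P_2,t_2):n_2\to m_2$: carrier $P_1\sqcup P_2$, order $(p,i)<(q,j)$ iff $i=j$ and $p<_iq$, source map $i\mapsto(s_1(i),1)$ for $i\le n_1$, $i\mapsto(s_2(i-n_1),2)$ for $i>n_1$, target map analogous. Gluing $P_1\ast P_2:n_1\to m_2$ (when $m_1=n_2$): carrier the quotient of $P_1\sqcup P_2$ identifying $(t_1(k),1)$ with $(s_2(k),2)$ for $k\in[m_1]$, order $(p,i)<(q,j)$ iff ($i=j$ and $p<_iq$) or ($i<j$, $p\notin t_1([m_1])$, $q\notin s_2([n_2])$), source induced by $s_1$, target by $t_2$. An iposet is gluing-parallel if it is empty or obtained from the four iposets on a one-point poset (with $0$ or $1$ source and $0$ or $1$ target points) by finitely many applications of $\ast$ and $\otimes$. An iposet $(s,P,t)$ is discrete if $P$ has empty order, a starter if discrete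 with $t$ bijective, a terminator if discrete with $s$ bijective, and Winkowski if $s([n])=P^{\min}$ and $t([m])=P^{\max}$. -}

module Defs where

open import Level using (0ℓ)
open import Data.Nat using (ℕ; zero; suc; _+_)
open import Data.Fin using (Fin; splitAt)
open import Data.Fin.Properties using (any?)
open import Data.Unit using (⊤; tt)
open import Data.Empty using (⊥)
open import Data.Bool.Properties using (T-irrelevant)
open import Data.Product using (Σ; ∃; _×_; _,_)
open import Data.Sum using (_⊎_; inj₁; inj₂; [_,_])
import Data.Sum.Properties as SumP
open import Relation.Nullary using (¬_; Dec; yes; no)
open import Relation.Nullary.Decidable using (False; fromWitnessFalse)
open import Relation.Binary using (Rel; DecidableEquality)
open import Relation.Binary.PropositionalEquality using (_≡_; refl; cong)
open import Function using (_∘_)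

-- Iposets  (s , P , t) : n → m.
-- The carrier is an arbitrary type with decidable equality (needed to
-- compute the quotient in gluing); the iposet axioms are in IsIposet.

record Iposet (n m : ℕ) : Set₁ where
  field
    Carrier : Set
    _≟_     : DecidableEquality Carrier
    _<_     : Rel Carrier 0ℓ
    src     : Fin n → Carrier
    tgt     : Fin m → Carrier

module _ {n m : ℕ} (P : Iposet n m) where
  open Iposet P

  Minimal : Carrier → Set
  Minimal p = ∀ q → ¬ (q < p)

  Maximal : Carrier → Set
  Maximal p = ∀ q → ¬ (p < q)

  record IsIposet : Set where
    field
      irrefl  : ∀ p → ¬ (p < p)
      trans   : ∀ {p q r} → p < q → q < r → p < r
      src-inj : ∀ i j → src i ≡ src j → i ≡ j
      tgt-inj : ∀ i j → tgt i ≡ tgt j → i ≡ j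
      src-min : ∀ i → Minimal (src i)
      tgt-max : ∀ j → Maximal (tgt j)

  Discrete : Set
  Discrete = ∀ p q → ¬ (p < q)

  -- starter: discrete with t bijective (t injective is part of IsIposet;
  -- we add surjectivity)
  Starter : Set
  Starter = Discrete × (∀ p → ∃ λ j → tgt j ≡ p)

  Terminator : Set
  Terminator = Discrete × (∀ p → ∃ λ i → src i ≡ p)

  Winkowski : Set
  Winkowski = (∀ p → Minimal p → ∃ λ i → src i ≡ p)
            × (∀ p → ∃ (λ i → src i ≡ p) → Minimal p)
            × (∀ p → Maximal p → ∃ λ j → tgt j ≡ p)
            × (∀ p → ∃ (λ j → tgt j ≡ p) → Maximal p)

record _≅_ {n m : ℕ} (P Q : Iposet n m) : Set where
  private
    module P = Iposet P
    module Q = Iposet Q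
  field
    to       : P.Carrier → Q.Carrier
    from     : Q.Carrier → P.Carrier
    from-to  : ∀ p → from (to p) ≡ p
    to-from  : ∀ q → to (from q) ≡ q
    to-mono  : ∀ p p' → P._<_ p p' → Q._<_ (to p) (to p')
    to-refl  : ∀ p p' → Q._<_ (to p) (to p') → P._<_ p p'
    to-src   : ∀ i → to (P.src i) ≡ Q.src i
    to-tgt   : ∀ j → to (P.tgt j) ≡ Q.tgt j

data ParLt {A B : Set} (R : Rel A 0ℓ) (S : Rel B 0ℓ) : Rel (A ⊎ B) 0ℓ where
  lt₁ : ∀ {a a'} → R a a' → ParLt R S (inj₁ a) (inj₁ a')
  lt₂ : ∀ {b b'} → S b b' → ParLt R S (inj₂ b) (inj₂ b')

_⊗_ : ∀ {n₁ m₁ n₂ m₂} → Iposet n₁ m₁ → Iposet n₂ m₂ → Iposet (n₁ + n₂) (m₁ + m₂)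
_⊗_ {n₁} {m₁} P Q = record
  { Carrier = P.Carrier ⊎ Q.Carrier
  ; _≟_     = SumP.≡-dec P._≟_ Q._≟_
  ; _<_     = ParLt P._<_ Q._<_
  ; src     = [ inj₁ ∘ P.src , inj₂ ∘ Q.src ] ∘ splitAt n₁
  ; tgt     = [ inj₁ ∘ P.tgt , inj₂ ∘ Q.tgt ] ∘ splitAt m₁
  }
  where
    module P = Iposet P
    module Q = Iposet Q

-- Gluing  P ∗ Q  (P : n → k, Q : k → m).
-- The quotient of P ⊔ Q identifying t_P(i) with s_Q(i) is represented
-- by the set of representatives  P ⊎ {q ∈ Q | q ∉ s_Q([k])}.

module Glue {n k m : ℕ} (P : Iposet n k) (Q : Iposet k m) where
  private
    module P = Iposet P
    module Q = Iposet Q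

  inSrcQ? : (q : Q.Carrier) → Dec (∃ λ i → Q.src i ≡ q)
  inSrcQ? q = any? (λ i → Q.src i Q.≟ q)

  Carrier : Set
  Carrier = P.Carrier ⊎ Σ Q.Carrier (λ q → False (inSrcQ? q))

  _≟_ : DecidableEquality Carrier
  inj₁ p ≟ inj₁ p' with p P.≟ p'
  ... | yes refl = yes refl
  ... | no ne    = no λ { refl → ne refl }
  inj₁ _ ≟ inj₂ _ = no λ ()
  inj₂ _ ≟ inj₁ _ = no λ ()
  inj₂ (q , a) ≟ inj₂ (q' , a') with q Q.≟ q'
  ... | yes refl = yes (cong (λ z → inj₂ (q , z)) (T-irrelevant a a'))
  ... | no ne    = no λ { refl → ne refl }

  Rep₁ : Carrier → P.Carrier → Set
  Rep₁ (inj₁ p) p' = p ≡ p'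
  Rep₁ (inj₂ _) _  = ⊥

  Rep₂ : Carrier → Q.Carrier → Set
  Rep₂ (inj₁ p) q        = ∃ λ i → P.tgt i ≡ p × Q.src i ≡ q
  Rep₂ (inj₂ (q' , _)) q = q' ≡ q

  -- (p,i) < (q,j) iff (i = j and p <_i q) or (i < j, p ∉ t_P, q ∉ s_Q),
  -- for some representatives of the two classes
  _<_ : Rel Carrier 0ℓ
  x < y = (∃ λ p → ∃ λ p' → Rep₁ x p × Rep₁ y p' × P._<_ p p')
        ⊎ (∃ λ q → ∃ λ q' → Rep₂ x q × Rep₂ y q' × Q._<_ q q')
        ⊎ (∃ λ p → ∃ λ q → Rep₁ x p × Rep₂ y q
                          × ¬ (∃ λ i → P.tgt i ≡ p) × ¬ (∃ λ i → Q.src i ≡ q))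

  src : Fin n → Carrier
  src = inj₁ ∘ P.src

  tgt : Fin m → Carrier
  tgt j with inSrcQ? (Q.tgt j)
  ... | yes (i , _) = inj₁ (P.tgt i)
  ... | no ¬e       = inj₂ (Q.tgt j , fromWitnessFalse ¬e)

  iposet : Iposet n m
  iposet = record { Carrier = Carrier ; _≟_ = _≟_ ; _<_ = _<_ ; src = src ; tgt = tgt }

_∗_ : ∀ {n k m} → Iposet n k → Iposet k m → Iposet n m
P ∗ Q = Glue.iposet P Q

emptyI : Iposet 0 0
emptyI = record { Carrier = ⊥ ; _≟_ = λ () ; _<_ = λ _ _ → ⊥ ; src = λ () ; tgt = λ () }

pointI : (n m : ℕ) → (Fin n → ⊤) → (Fin m → ⊤) → Iposet n m
pointI n m s t = record
  { Carrier = ⊤ ; _≟_ = λ { tt tt → yes refl } ; _<_ = λ _ _ → ⊥ ; src = s ; tgt = t }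

point : (n m : ℕ) → Iposet n m
point n m = pointI n m (λ _ → tt) (λ _ → tt)

data GPTerm : ℕ → ℕ → Set where
  empty : GPTerm 0 0
  pt₀₀  : GPTerm 0 0
  pt₀₁  : GPTerm 0 1
  pt₁₀  : GPTerm 1 0
  pt₁₁  : GPTerm 1 1
  par   : ∀ {n₁ m₁ n₂ m₂} → GPTerm n₁ m₁ → GPTerm n₂ m₂ → GPTerm (n₁ + n₂) (m₁ + m₂)
  glue  : ∀ {n k m} → GPTerm n k → GPTerm k m → GPTerm n m

⟦_⟧ : ∀ {n m} → GPTerm n m → Iposet n m
⟦ empty ⟧    = emptyI
⟦ pt₀₀ ⟧     = point 0 0
⟦ pt₀₁ ⟧     = point 0 1
⟦ pt₁₀ ⟧     = point 1 0
⟦ pt₁₁ ⟧     = point 1 1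
⟦ par s t ⟧  = ⟦ s ⟧ ⊗ ⟦ t ⟧
⟦ glue s t ⟧ = ⟦ s ⟧ ∗ ⟦ t ⟧

GluingParallel : ∀ {n m} → Iposet n m → Set
GluingParallel {n} {m} P = Σ (GPTerm n m) λ e → P ≅ ⟦ e ⟧

-- By induction on a gluing-parallel term e we show that ⟦ e ⟧ is, as a poset,
-- isomorphic to a Winkowski term W whose interfaces contain those of e in order:
-- sources of e go to sources of W along an order-preserving injection (a thinning),
-- and likewise for targets.  The starter S and terminator T are the discrete iposets
-- realising these two thinnings, and then ⟦ e ⟧ ≅ S ∗ W ∗ T.  For a gluing P₁ ∗ P₂: if every point of P₁ is a target,
-- P₁ ∗ P₂ is P₂ with fewer sources; dually if every point of P₂ is a source;
-- otherwise W₁ ∗ T₁ ∗ S₂ ∗ W₂ is again Winkowski, because a non-target of P₁ lies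
-- below every point contributed by P₂ alone (and dually), so minimal points come
-- from W₁ and maximal ones from W₂.  Thinnings suffice because a gluing-parallel
-- iposet never reorders the sources it identifies with targets.

module Submission where

open import Defs
open import Data.Nat as ℕ using (ℕ; zero; suc; _+_; z≤n; s≤s)
import Data.Nat.Properties as ℕP
open import Data.Fin as Fin using (Fin; zero; suc; splitAt; toℕ; _↑ˡ_; _↑ʳ_)
import Data.Fin.Properties as FinP
open import Data.Fin.Properties using (any?)
open import Data.Unit using (tt)
open import Data.Empty using (⊥-elim)
open import Data.Bool.Properties using (T-irrelevant)
open import Data.Product using (Σ; ∃; _×_; _,_; proj₁; proj₂)
open import Data.Sum as Sum using (_⊎_; inj₁; inj₂)
import Data.Sum.Properties as SumP
open import Data.List using (List; []; _∷_; _++_; map)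
import Data.List.Relation.Unary.All as All
import Data.List.Relation.Unary.Any as Any
open import Data.List.Membership.Propositional.Properties using (∈-map⁺; ∈-++⁺ˡ; ∈-++⁺ʳ)
open import Relation.Nullary using (¬_; yes; no)
open import Relation.Nullary.Decidable using (fromWitnessFalse; toWitnessFalse; toSum)
open import Relation.Unary using (Decidable)
open import Relation.Binary using (tri<; tri≈; tri>)
open import Relation.Binary.PropositionalEquality
  using (_≡_; _≢_; _≗_; refl; cong; sym; trans; subst; subst₂; setoid; module ≡-Reasoning)
open import Data.List.Relation.Unary.Enumerates.Setoid using (IsEnumeration)
open import Function using (_∘_; id)

module _ {n m} (P : Iposet n m) where
  open Iposet P

  IsSource : Carrier → Set
  IsSource p = ∃ λ i → src i ≡ p

  IsTarget : Carrier → Set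
  IsTarget p = ∃ λ j → tgt j ≡ p

  isSource? : Decidable IsSource
  isSource? p = any? λ i → src i ≟ p

  isTarget? : Decidable IsTarget
  isTarget? p = any? λ j → tgt j ≟ p

  MinimalsAreSources : Set
  MinimalsAreSources = ∀ p → Minimal P p → IsSource p

  MaximalsAreTargets : Set
  MaximalsAreTargets = ∀ p → Maximal P p → IsTarget p

winkowski : ∀ {n m} {P : Iposet n m} → IsIposet P →
            MinimalsAreSources P → MaximalsAreTargets P → Winkowski P
winkowski IP minimals maximals =
  minimals , (λ { _ (i , refl) → src-min i }) , maximals , (λ { _ (j , refl) → tgt-max j })
  where open IsIposet IP

-- An isomorphism of the underlying posets; the interfaces are not required to match.
record _≃_ {n m n' m'} (P : Iposet n m) (Q : Iposet n' m') : Set where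
  private
    module P = Iposet P
    module Q = Iposet Q
  field
    to        : P.Carrier → Q.Carrier
    from      : Q.Carrier → P.Carrier
    from-to   : ∀ p → from (to p) ≡ p
    to-from   : ∀ q → to (from q) ≡ q
    to-mono   : ∀ {p p'} → p P.< p' → to p Q.< to p'
    from-mono : ∀ {q q'} → q Q.< q' → from q P.< from q'

open _≃_

module _ {n m n' m'} {P : Iposet n m} {Q : Iposet n' m'} where
  private
    module P = Iposet P
    module Q = Iposet Q

  ≃-sym : P ≃ Q → Q ≃ P
  ≃-sym φ = record
    { to = from φ ; from = to φ ; from-to = to-from φ ; to-from = from-to φ
    ; to-mono = from-mono φ ; from-mono = to-mono φ }

  to-injective : (φ : P ≃ Q) → ∀ {p p'} → to φ p ≡ to φ p' → p ≡ p'
  to-injective φ {p} {p'} eq = begin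
    p                ≡⟨ sym (from-to φ p) ⟩
    from φ (to φ p)  ≡⟨ cong (from φ) eq ⟩
    from φ (to φ p') ≡⟨ from-to φ p' ⟩
    p'               ∎
    where open ≡-Reasoning

  to-Minimal : (φ : P ≃ Q) → ∀ {p} → Minimal P p → Minimal Q (to φ p)
  to-Minimal φ {p} p-min q q<φp =
    p-min (from φ q) (subst (from φ q P.<_) (from-to φ p) (from-mono φ q<φp))

  to-Maximal : (φ : P ≃ Q) → ∀ {p} → Maximal P p → Maximal Q (to φ p)
  to-Maximal φ {p} p-max q φp<q =
    p-max (from φ q) (subst (P._< from φ q) (from-to φ p) (from-mono φ φp<q))

≃-refl : ∀ {n m} {P : Iposet n m} → P ≃ P
≃-refl = record
  { to = id ; from = id ; from-to = λ _ → refl ; to-from = λ _ → refl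
  ; to-mono = id ; from-mono = id }

≃-trans : ∀ {n m n' m' n'' m''} {P : Iposet n m} {Q : Iposet n' m'} {R : Iposet n'' m''} →
          P ≃ Q → Q ≃ R → P ≃ R
≃-trans φ ψ = record
  { to = to ψ ∘ to φ ; from = from φ ∘ from ψ
  ; from-to = λ p → trans (cong (from φ) (from-to ψ (to φ p))) (from-to φ p)
  ; to-from = λ r → trans (cong (to ψ) (to-from φ (from ψ r))) (to-from ψ r)
  ; to-mono = to-mono ψ ∘ to-mono φ ; from-mono = from-mono φ ∘ from-mono ψ }

module _ {n m m'} {P : Iposet n m} {Q : Iposet n m'} where
  private
    module P = Iposet P
    module Q = Iposet Q

  PreservesSources : P ≃ Q → Set
  PreservesSources φ = ∀ i → to φ (P.src i) ≡ Q.src i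

  MinimalsAreSources-≃ : (φ : P ≃ Q) → PreservesSources φ →
                         MinimalsAreSources Q → MinimalsAreSources P
  MinimalsAreSources-≃ φ φ-src Q-min p p-min =
    let (i , eq) = Q-min (to φ p) (to-Minimal φ p-min)
    in i , to-injective φ (trans (φ-src i) eq)

  IsSource-to⁻ : (φ : P ≃ Q) → PreservesSources φ → ∀ {p} → IsSource Q (to φ p) → IsSource P p
  IsSource-to⁻ φ φ-src (i , eq) = i , to-injective φ (trans (φ-src i) eq)

module _ {n n' m} {P : Iposet n m} {Q : Iposet n' m} where
  private
    module P = Iposet P
    module Q = Iposet Q

  PreservesTargets : P ≃ Q → Set
  PreservesTargets φ = ∀ j → to φ (P.tgt j) ≡ Q.tgt j

  MaximalsAreTargets-≃ : (φ : P ≃ Q) → PreservesTargets φ →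
                         MaximalsAreTargets Q → MaximalsAreTargets P
  MaximalsAreTargets-≃ φ φ-tgt Q-max p p-max =
    let (j , eq) = Q-max (to φ p) (to-Maximal φ p-max)
    in j , to-injective φ (trans (φ-tgt j) eq)

  IsTarget-to⁻ : (φ : P ≃ Q) → PreservesTargets φ → ∀ {p} → IsTarget Q (to φ p) → IsTarget P p
  IsTarget-to⁻ φ φ-tgt (j , eq) = j , to-injective φ (trans (φ-tgt j) eq)

PreservesSources-sym : ∀ {n m m'} {P : Iposet n m} {Q : Iposet n m'} (φ : P ≃ Q) →
                       PreservesSources φ → PreservesSources (≃-sym φ)
PreservesSources-sym {P = P} φ φ-src i =
  trans (cong (from φ) (sym (φ-src i))) (from-to φ (Iposet.src P i))

PreservesTargets-sym : ∀ {n n' m} {P : Iposet n m} {Q : Iposet n' m} (φ : P ≃ Q) →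
                       PreservesTargets φ → PreservesTargets (≃-sym φ)
PreservesTargets-sym {P = P} φ φ-tgt j =
  trans (cong (from φ) (sym (φ-tgt j))) (from-to φ (Iposet.tgt P j))

≅-refl : ∀ {n m} {P : Iposet n m} → P ≅ P
≅-refl = record
  { to = id ; from = id ; from-to = λ _ → refl ; to-from = λ _ → refl
  ; to-mono = λ _ _ → id ; to-refl = λ _ _ → id ; to-src = λ _ → refl ; to-tgt = λ _ → refl }

≃⇒≅ : ∀ {n m} {P Q : Iposet n m} (φ : P ≃ Q) → PreservesSources φ → PreservesTargets φ → P ≅ Q
≃⇒≅ {P = P} φ φ-src φ-tgt = record
  { to      = to φ
  ; from    = from φ
  ; from-to = from-to φ
  ; to-from = to-from φ
  ; to-mono = λ _ _ → to-mono φ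
  ; to-refl = λ p p' φp<φp' → subst₂ (Iposet._<_ P) (from-to φ p) (from-to φ p') (from-mono φ φp<φp')
  ; to-src  = φ-src
  ; to-tgt  = φ-tgt }

≅-trans : ∀ {n m} {P Q R : Iposet n m} → P ≅ Q → Q ≅ R → P ≅ R
≅-trans ψ χ = record
  { to      = χ.to ∘ ψ.to
  ; from    = ψ.from ∘ χ.from
  ; from-to = λ p → trans (cong ψ.from (χ.from-to (ψ.to p))) (ψ.from-to p)
  ; to-from = λ r → trans (cong χ.to (ψ.to-from (χ.from r))) (χ.to-from r)
  ; to-mono = λ p p' → χ.to-mono _ _ ∘ ψ.to-mono p p'
  ; to-refl = λ p p' → ψ.to-refl p p' ∘ χ.to-refl _ _
  ; to-src  = λ i → trans (cong χ.to (ψ.to-src i)) (χ.to-src i)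
  ; to-tgt  = λ j → trans (cong χ.to (ψ.to-tgt j)) (χ.to-tgt j) }
  where
  module ψ = _≅_ ψ
  module χ = _≅_ χ

module Gluing {n k m} (A : Iposet n k) (B : Iposet k m) where
  private
    module A = Iposet A
    module B = Iposet B
  open Glue A B public

  ι₂ : B.Carrier → Carrier
  ι₂ b with inSrcQ? b
  ... | yes (i , _) = inj₁ (A.tgt i)
  ... | no b∉src    = inj₂ (b , fromWitnessFalse b∉src)

  tgt≡ι₂ : ∀ j → tgt j ≡ ι₂ (B.tgt j)
  tgt≡ι₂ j with inSrcQ? (B.tgt j)
  ... | yes _ = refl
  ... | no _  = refl

  Rep₂-ι₂ : ∀ b → Rep₂ (ι₂ b) b
  Rep₂-ι₂ b with inSrcQ? b
  ... | yes (i , eq) = i , refl , eq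
  ... | no _         = refl

  ι₂-fresh : ∀ b b∉src → ι₂ b ≡ inj₂ (b , b∉src)
  ι₂-fresh b b∉src = fresh (ι₂ b) (Rep₂-ι₂ b)
    where
    fresh : ∀ x → Rep₂ x b → x ≡ inj₂ (b , b∉src)
    fresh (inj₁ _) (i , _ , eq)      = ⊥-elim (toWitnessFalse b∉src (i , eq))
    fresh (inj₂ (.b , b∉src')) refl = cong (λ b∉src → inj₂ (b , b∉src)) (T-irrelevant b∉src' b∉src)

  inj₁≡ι₂ : ∀ {a b} → inj₁ a ≡ ι₂ b → ∃ λ i → A.tgt i ≡ a × B.src i ≡ b
  inj₁≡ι₂ {b = b} eq with inSrcQ? b
  inj₁≡ι₂ refl | yes (i , eq) = i , refl , eq
  inj₁≡ι₂ ()   | no _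

  inj₁≡ι₂⇒IsTarget : ∀ {a b} → inj₁ a ≡ ι₂ b → IsTarget A a
  inj₁≡ι₂⇒IsTarget eq = let (i , a≡ , _) = inj₁≡ι₂ eq in i , a≡

  inj₁≡ι₂⇒IsSource : ∀ {a b} → inj₁ a ≡ ι₂ b → IsSource B b
  inj₁≡ι₂⇒IsSource eq = let (i , _ , b≡) = inj₁≡ι₂ eq in i , b≡

  inj₁-or-ι₂ : ∀ x → (∃ λ a → inj₁ a ≡ x) ⊎ (∃ λ b → ι₂ b ≡ x)
  inj₁-or-ι₂ (inj₁ a)             = inj₁ (a , refl)
  inj₁-or-ι₂ (inj₂ (b , b∉src)) = inj₂ (b , ι₂-fresh b b∉src)

  <-inj₁ : ∀ {a a'} → a A.< a' → inj₁ a < inj₁ a'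
  <-inj₁ {a} {a'} a<a' = inj₁ (a , a' , refl , refl , a<a')

  <-ι₂ : ∀ {b b'} → b B.< b' → ι₂ b < ι₂ b'
  <-ι₂ {b} {b'} b<b' = inj₂ (inj₁ (b , b' , Rep₂-ι₂ b , Rep₂-ι₂ b' , b<b'))

  <-across : ∀ {a b} → ¬ IsTarget A a → ¬ IsSource B b → inj₁ a < ι₂ b
  <-across {a} {b} a∉tgt b∉src = inj₂ (inj₂ (a , b , refl , Rep₂-ι₂ b , a∉tgt , b∉src))

  inj₁-Minimal⁻ : ∀ {a} → Minimal iposet (inj₁ a) → Minimal A a
  inj₁-Minimal⁻ min a' a'<a = min (inj₁ a') (<-inj₁ a'<a)

  ι₂-Maximal⁻ : ∀ {b} → Maximal iposet (ι₂ b) → Maximal B b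
  ι₂-Maximal⁻ max b' b<b' = max (ι₂ b') (<-ι₂ b<b')

  module Properties (IA : IsIposet A) (IB : IsIposet B) where
    private
      module IA = IsIposet IA
      module IB = IsIposet IB

    ι₂-src : ∀ i → ι₂ (B.src i) ≡ inj₁ (A.tgt i)
    ι₂-src i with inSrcQ? (B.src i)
    ... | yes (i' , eq) = cong (inj₁ ∘ A.tgt) (IB.src-inj i' i eq)
    ... | no b∉src      = ⊥-elim (b∉src (i , refl))

    ι₂-injective : ∀ {b b'} → ι₂ b ≡ ι₂ b' → b ≡ b'
    ι₂-injective {b} {b'} eq with inSrcQ? b | inSrcQ? b'
    ... | yes (i , eqᵢ) | yes (i' , eqᵢ') =
      trans (sym eqᵢ) (trans (cong B.src (IA.tgt-inj i i' (SumP.inj₁-injective eq))) eqᵢ')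
    ... | no _ | no _ = cong proj₁ (SumP.inj₂-injective eq)
    ι₂-injective () | yes _ | no _
    ι₂-injective () | no _  | yes _

    tgt≡inj₁ : ∀ {j c} → B.src c ≡ B.tgt j → tgt j ≡ inj₁ (A.tgt c)
    tgt≡inj₁ {j} {c} eq = trans (tgt≡ι₂ j) (trans (cong ι₂ (sym eq)) (ι₂-src c))

    Rep₂⇒ι₂ : ∀ {x b} → Rep₂ x b → ι₂ b ≡ x
    Rep₂⇒ι₂ {inj₁ a} (i , a≡ , refl) = trans (ι₂-src i) (cong inj₁ a≡)
    Rep₂⇒ι₂ {inj₂ (b , b∉src)} refl  = ι₂-fresh b b∉src

    -- The order of A ∗ B read through the embeddings inj₁ and ι₂ instead of representatives.
    data <-View (x y : Carrier) : Set where
      inside₁ : ∀ {a a'} → inj₁ a ≡ x → inj₁ a' ≡ y → a A.< a' → <-View x y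
      inside₂ : ∀ {b b'} → ι₂ b ≡ x → ι₂ b' ≡ y → b B.< b' → <-View x y
      across  : ∀ {a b} → inj₁ a ≡ x → ι₂ b ≡ y → ¬ IsTarget A a → ¬ IsSource B b → <-View x y

    <-view : ∀ {x y} → x < y → <-View x y
    <-view {inj₁ a} {inj₁ a'} (inj₁ (.a , .a' , refl , refl , a<a')) = inside₁ refl refl a<a'
    <-view (inj₂ (inj₁ (_ , _ , rep , rep' , b<b'))) = inside₂ (Rep₂⇒ι₂ rep) (Rep₂⇒ι₂ rep') b<b'
    <-view {inj₁ a} (inj₂ (inj₂ (.a , _ , refl , rep , a∉tgt , b∉src))) =
      across refl (Rep₂⇒ι₂ rep) a∉tgt b∉src

    <⇒¬IsTarget : ∀ {a a'} → a A.< a' → ¬ IsTarget A a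
    <⇒¬IsTarget {a' = a'} a<a' (i , refl) = IA.tgt-max i a' a<a'

    <⇒¬IsSource : ∀ {b b'} → b B.< b' → ¬ IsSource B b'
    <⇒¬IsSource {b = b} b<b' (i , refl) = IB.src-min i b b<b'

    <-irrefl : ∀ x → ¬ (x < x)
    <-irrefl x x<x with <-view x<x
    ... | inside₁ refl refl a<a = IA.irrefl _ a<a
    ... | inside₂ refl eq b<b'  = IB.irrefl _ (subst (_ B.<_) (ι₂-injective eq) b<b')
    ... | across refl eq a∉tgt _ = a∉tgt (inj₁≡ι₂⇒IsTarget (sym eq))

    <-trans : ∀ {x y z} → x < y → y < z → x < z
    <-trans x<y y<z = combine (<-view x<y) (<-view y<z)
      where
      combine : ∀ {x y z} → <-View x y → <-View y z → x < z
      combine (inside₁ refl refl a<a') (inside₁ refl refl a'<a'') = <-inj₁ (IA.trans a<a' a'<a'')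
      combine (inside₁ refl refl a<a') (inside₂ _ refl c<c') = <-across (<⇒¬IsTarget a<a') (<⇒¬IsSource c<c')
      combine (inside₁ refl refl a<a') (across _ refl _ b∉src) = <-across (<⇒¬IsTarget a<a') b∉src
      combine (inside₂ refl refl b<b') (inside₁ eq _ _) = ⊥-elim (<⇒¬IsSource b<b' (inj₁≡ι₂⇒IsSource eq))
      combine (inside₂ refl refl b<b') (inside₂ eq refl c<c') =
        <-ι₂ (IB.trans b<b' (subst (B._< _) (ι₂-injective eq) c<c'))
      combine (inside₂ refl refl b<b') (across eq _ _ _) = ⊥-elim (<⇒¬IsSource b<b' (inj₁≡ι₂⇒IsSource eq))
      combine (across refl refl _ b∉src) (inside₁ eq _ _) = ⊥-elim (b∉src (inj₁≡ι₂⇒IsSource eq))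
      combine (across refl refl a∉tgt _) (inside₂ _ refl c<c') = <-across a∉tgt (<⇒¬IsSource c<c')
      combine (across refl refl _ b∉src) (across eq _ _ _) = ⊥-elim (b∉src (inj₁≡ι₂⇒IsSource eq))

    src-Minimal : ∀ i → Minimal iposet (src i)
    src-Minimal i y y<src with <-view y<src
    ... | inside₁ _ refl a<src   = IA.src-min i _ a<src
    ... | inside₂ _ eq b<b'      = <⇒¬IsSource b<b' (inj₁≡ι₂⇒IsSource (sym eq))
    ... | across _ eq _ b∉src    = b∉src (inj₁≡ι₂⇒IsSource (sym eq))

    tgt-Maximal : ∀ j → Maximal iposet (tgt j)
    tgt-Maximal j y tgt<y with <-view (subst (_< y) (tgt≡ι₂ j) tgt<y)
    ... | inside₁ eq _ a<a'     = <⇒¬IsTarget a<a' (inj₁≡ι₂⇒IsTarget eq)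
    ... | inside₂ eq _ b<b'     = IB.tgt-max j _ (subst (B._< _) (ι₂-injective eq) b<b')
    ... | across eq _ a∉tgt _   = a∉tgt (inj₁≡ι₂⇒IsTarget eq)

    isIposet : IsIposet iposet
    isIposet = record
      { irrefl  = <-irrefl
      ; trans   = <-trans
      ; src-inj = λ i j eq → IA.src-inj i j (SumP.inj₁-injective eq)
      ; tgt-inj = λ i j eq → IB.tgt-inj i j (ι₂-injective (trans (sym (tgt≡ι₂ i)) (trans eq (tgt≡ι₂ j))))
      ; src-min = src-Minimal
      ; tgt-max = tgt-Maximal }

    Minimal∈inj₁ : ∀ {u} → ¬ IsTarget A u → ∀ x → Minimal iposet x → ∃ λ a → inj₁ a ≡ x
    Minimal∈inj₁ u∉tgt (inj₁ a) _ = a , refl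
    Minimal∈inj₁ {u} u∉tgt (inj₂ (b , b∉src)) x-min =
      ⊥-elim (x-min (inj₁ u) (subst (inj₁ u <_) (ι₂-fresh b b∉src) (<-across u∉tgt (toWitnessFalse b∉src))))

    Maximal∈ι₂ : ∀ {v} → ¬ IsSource B v → ∀ x → Maximal iposet x → ∃ λ b → ι₂ b ≡ x
    Maximal∈ι₂ {v} v∉src (inj₁ a) x-max with isTarget? A a
    ... | yes (i , a≡) = B.src i , trans (ι₂-src i) (cong inj₁ a≡)
    ... | no a∉tgt     = ⊥-elim (x-max (ι₂ v) (<-across a∉tgt v∉src))
    Maximal∈ι₂ v∉src (inj₂ (b , b∉src)) _ = b , ι₂-fresh b b∉src

    -- A non-target of A lies below every point coming from B alone.
    minimalsAreSources : ∀ {u} → ¬ IsTarget A u → MinimalsAreSources A → MinimalsAreSources iposet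
    minimalsAreSources u∉tgt A-min x x-min with Minimal∈inj₁ u∉tgt x x-min
    ... | a , refl = let (i , eq) = A-min a (inj₁-Minimal⁻ x-min) in i , cong inj₁ eq

    maximalsAreTargets : ∀ {v} → ¬ IsSource B v → MaximalsAreTargets B → MaximalsAreTargets iposet
    maximalsAreTargets v∉src B-max x x-max with Maximal∈ι₂ v∉src x x-max
    ... | b , refl = let (j , eq) = B-max b (ι₂-Maximal⁻ x-max) in j , trans (tgt≡ι₂ j) (cong ι₂ eq)

∗-isIposet : ∀ {n k m} {A : Iposet n k} {B : Iposet k m} → IsIposet A → IsIposet B → IsIposet (A ∗ B)
∗-isIposet {A = A} {B} = Gluing.Properties.isIposet A B

module _ {n k m} {S : Iposet n k} {B : Iposet k m} (IS : IsIposet S) (IB : IsIposet B)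
         (S-tgt : ∀ s → IsTarget S s) where
  private
    module S = Iposet S
    module B = Iposet B
    module IS = IsIposet IS
    open Gluing S B
    open Properties IS IB

    toB : Carrier → B.Carrier
    toB (inj₁ s)       = B.src (proj₁ (S-tgt s))
    toB (inj₂ (b , _)) = b

    toB-ι₂ : ∀ b → toB (ι₂ b) ≡ b
    toB-ι₂ b with inSrcQ? b
    ... | yes (i , eq) = trans (cong B.src (IS.tgt-inj _ i (proj₂ (S-tgt (S.tgt i))))) eq
    ... | no _         = refl

    ι₂-toB : ∀ x → ι₂ (toB x) ≡ x
    ι₂-toB (inj₁ s)             = trans (ι₂-src _) (cong inj₁ (proj₂ (S-tgt s)))
    ι₂-toB (inj₂ (b , b∉src)) = ι₂-fresh b b∉src

    toB-mono : ∀ {x y} → x < y → toB x B.< toB y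
    toB-mono x<y with <-view x<y
    ... | inside₁ {a} _ _ a<a'       = ⊥-elim (<⇒¬IsTarget a<a' (S-tgt a))
    ... | inside₂ refl refl b<b'     = subst₂ B._<_ (sym (toB-ι₂ _)) (sym (toB-ι₂ _)) b<b'
    ... | across {a} _ _ a∉tgt _     = ⊥-elim (a∉tgt (S-tgt a))

  ∗-unitˡ : (S ∗ B) ≃ B
  ∗-unitˡ = record
    { to = toB ; from = ι₂ ; from-to = ι₂-toB ; to-from = toB-ι₂
    ; to-mono = toB-mono ; from-mono = <-ι₂ }

  ∗-unitˡ-src : ∀ i c → S.tgt c ≡ S.src i → to ∗-unitˡ (src i) ≡ B.src c
  ∗-unitˡ-src i c eq = cong B.src (IS.tgt-inj _ c (trans (proj₂ (S-tgt (S.src i))) (sym eq)))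

  ∗-unitˡ-tgt : PreservesTargets ∗-unitˡ
  ∗-unitˡ-tgt j = trans (cong toB (tgt≡ι₂ j)) (toB-ι₂ (B.tgt j))

module _ {n k m} {A : Iposet n k} {T : Iposet k m} (IA : IsIposet A) (IT : IsIposet T)
         (T-src : ∀ t → IsSource T t) where
  private
    module A = Iposet A
    module T = Iposet T
    open Gluing A T
    open Properties IA IT

    toA : Carrier → A.Carrier
    toA (inj₁ a)             = a
    toA (inj₂ (t , t∉src)) = ⊥-elim (toWitnessFalse t∉src (T-src t))

    inj₁-toA : ∀ x → inj₁ (toA x) ≡ x
    inj₁-toA (inj₁ a)             = refl
    inj₁-toA (inj₂ (t , t∉src)) = ⊥-elim (toWitnessFalse t∉src (T-src t))

    toA-mono : ∀ {x y} → x < y → toA x A.< toA y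
    toA-mono x<y with <-view x<y
    ... | inside₁ refl refl a<a'     = a<a'
    ... | inside₂ {b' = b'} _ _ b<b' = ⊥-elim (<⇒¬IsSource b<b' (T-src b'))
    ... | across {b = b} _ _ _ b∉src = ⊥-elim (b∉src (T-src b))

  ∗-unitʳ : (A ∗ T) ≃ A
  ∗-unitʳ = record
    { to = toA ; from = inj₁ ; from-to = inj₁-toA ; to-from = λ _ → refl
    ; to-mono = toA-mono ; from-mono = <-inj₁ }

  ∗-unitʳ-src : PreservesSources ∗-unitʳ
  ∗-unitʳ-src i = refl

  ∗-unitʳ-tgt : ∀ j c → T.src c ≡ T.tgt j → to ∗-unitʳ (tgt j) ≡ A.tgt c
  ∗-unitʳ-tgt j c eq = cong toA (tgt≡inj₁ eq)

∗-map : ∀ {n n' k m m'} {A : Iposet n k} {A' : Iposet n' k} {B : Iposet k m} {B' : Iposet k m'} →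
        A ≃ A' → B ≃ B' → Gluing.Carrier A B → Gluing.Carrier A' B'
∗-map                     φ ψ (inj₁ a)       = inj₁ (to φ a)
∗-map {A' = A'} {B' = B'} φ ψ (inj₂ (b , _)) = Gluing.ι₂ A' B' (to ψ b)

module _ {n n' k m m'} {A : Iposet n k} {A' : Iposet n' k} {B : Iposet k m} {B' : Iposet k m'}
         (IA : IsIposet A) (IA' : IsIposet A') (IB : IsIposet B) (IB' : IsIposet B')
         (φ : A ≃ A') (ψ : B ≃ B') (φ-tgt : PreservesTargets φ) (ψ-src : PreservesSources ψ) where
  private
    module B = Iposet B
    module G  = Gluing A B
    module G' = Gluing A' B'
    module GP  = G.Properties IA IB
    module GP' = G'.Properties IA' IB'

  ∗-map-ι₂ : ∀ b → ∗-map φ ψ (G.ι₂ b) ≡ G'.ι₂ (to ψ b)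
  ∗-map-ι₂ b with G.inSrcQ? b
  ... | yes (i , refl) = begin
    inj₁ (to φ (Iposet.tgt A i))  ≡⟨ cong inj₁ (φ-tgt i) ⟩
    inj₁ (Iposet.tgt A' i)        ≡⟨ sym (GP'.ι₂-src i) ⟩
    G'.ι₂ (Iposet.src B' i)       ≡⟨ cong G'.ι₂ (sym (ψ-src i)) ⟩
    G'.ι₂ (to ψ (B.src i))        ∎
    where open ≡-Reasoning
  ... | no _ = refl

  ∗-map-mono : ∀ {x y} → x G.< y → ∗-map φ ψ x G'.< ∗-map φ ψ y
  ∗-map-mono x<y with GP.<-view x<y
  ... | GP.inside₁ refl refl a<a' = G'.<-inj₁ (to-mono φ a<a')
  ... | GP.inside₂ {b} {b'} refl refl b<b' =
    subst₂ G'._<_ (sym (∗-map-ι₂ b)) (sym (∗-map-ι₂ b')) (G'.<-ι₂ (to-mono ψ b<b'))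
  ... | GP.across {a} {b} refl refl a∉tgt b∉src =
    subst (inj₁ (to φ a) G'.<_) (sym (∗-map-ι₂ b))
      (G'.<-across (a∉tgt ∘ IsTarget-to⁻ φ φ-tgt) (b∉src ∘ IsSource-to⁻ ψ ψ-src))

module _ {n n' k m m'} {A : Iposet n k} {A' : Iposet n' k} {B : Iposet k m} {B' : Iposet k m'}
         (IA : IsIposet A) (IA' : IsIposet A') (IB : IsIposet B) (IB' : IsIposet B')
         (φ : A ≃ A') (ψ : B ≃ B') (φ-tgt : PreservesTargets φ) (ψ-src : PreservesSources ψ) where
  private
    module G  = Gluing A B
    module G' = Gluing A' B'

  ∗-map-inverse : ∀ x → ∗-map (≃-sym φ) (≃-sym ψ) (∗-map φ ψ x) ≡ x
  ∗-map-inverse (inj₁ a)             = cong inj₁ (from-to φ a)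
  ∗-map-inverse (inj₂ (b , b∉src)) = begin
    ∗-map (≃-sym φ) (≃-sym ψ) (G'.ι₂ (to ψ b))
      ≡⟨ ∗-map-ι₂ IA' IA IB' IB (≃-sym φ) (≃-sym ψ)
           (PreservesTargets-sym φ φ-tgt) (PreservesSources-sym ψ ψ-src) (to ψ b) ⟩
    G.ι₂ (from ψ (to ψ b))  ≡⟨ cong G.ι₂ (from-to ψ b) ⟩
    G.ι₂ b                  ≡⟨ G.ι₂-fresh b b∉src ⟩
    inj₂ (b , b∉src)        ∎
    where open ≡-Reasoning

∗-cong : ∀ {n n' k m m'} {A : Iposet n k} {A' : Iposet n' k} {B : Iposet k m} {B' : Iposet k m'}
         (IA : IsIposet A) (IA' : IsIposet A') (IB : IsIposet B) (IB' : IsIposet B')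
         (φ : A ≃ A') (ψ : B ≃ B') → PreservesTargets φ → PreservesSources ψ → (A ∗ B) ≃ (A' ∗ B')
∗-cong IA IA' IB IB' φ ψ φ-tgt ψ-src = record
  { to        = ∗-map φ ψ
  ; from      = ∗-map (≃-sym φ) (≃-sym ψ)
  ; from-to   = ∗-map-inverse IA IA' IB IB' φ ψ φ-tgt ψ-src
  ; to-from   = ∗-map-inverse IA' IA IB' IB (≃-sym φ) (≃-sym ψ) φ⁻-tgt ψ⁻-src
  ; to-mono   = ∗-map-mono IA IA' IB IB' φ ψ φ-tgt ψ-src
  ; from-mono = ∗-map-mono IA' IA IB' IB (≃-sym φ) (≃-sym ψ) φ⁻-tgt ψ⁻-src }
  where
  φ⁻-tgt : PreservesTargets (≃-sym φ)
  φ⁻-tgt = PreservesTargets-sym φ φ-tgt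
  ψ⁻-src : PreservesSources (≃-sym ψ)
  ψ⁻-src = PreservesSources-sym ψ ψ-src

map-square : ∀ {A₁ A₂ B₁ B₂ C₁ C₂ D₁ D₂ : Set}
             {f₁ : B₁ → D₁} {g₁ : A₁ → B₁} {h₁ : C₁ → D₁} {k₁ : A₁ → C₁}
             {f₂ : B₂ → D₂} {g₂ : A₂ → B₂} {h₂ : C₂ → D₂} {k₂ : A₂ → C₂} →
             f₁ ∘ g₁ ≗ h₁ ∘ k₁ → f₂ ∘ g₂ ≗ h₂ ∘ k₂ →
             Sum.map f₁ f₂ ∘ Sum.map g₁ g₂ ≗ Sum.map h₁ h₂ ∘ Sum.map k₁ k₂
map-square sq₁ sq₂ (inj₁ x) = cong inj₁ (sq₁ x)
map-square sq₁ sq₂ (inj₂ y) = cong inj₂ (sq₂ y)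

map∘splitAt-injective : ∀ {a b} {X Y : Set} {f : Fin a → X} {g : Fin b → Y} →
                        (∀ i j → f i ≡ f j → i ≡ j) → (∀ i j → g i ≡ g j → i ≡ j) →
                        ∀ i j → Sum.map f g (splitAt a i) ≡ Sum.map f g (splitAt a j) → i ≡ j
map∘splitAt-injective {a} {b} f-inj g-inj i j eq = begin
  i                             ≡⟨ sym (FinP.join-splitAt a b i) ⟩
  Fin.join a b (splitAt a i)    ≡⟨ cong (Fin.join a b) (map-injective (splitAt a i) (splitAt a j) eq) ⟩
  Fin.join a b (splitAt a j)    ≡⟨ FinP.join-splitAt a b j ⟩
  j                             ∎
  where
  open ≡-Reasoning
  map-injective : ∀ s t → Sum.map _ _ s ≡ Sum.map _ _ t → s ≡ t
  map-injective (inj₁ x) (inj₁ y) eq = cong inj₁ (f-inj x y (SumP.inj₁-injective eq))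
  map-injective (inj₂ x) (inj₂ y) eq = cong inj₂ (g-inj x y (SumP.inj₂-injective eq))

module _ {n₁ m₁ n₂ m₂} {P : Iposet n₁ m₁} {Q : Iposet n₂ m₂} where
  private
    module P = Iposet P
    module Q = Iposet Q
    module PQ = Iposet (P ⊗ Q)

  ⊗-src-↑ˡ : ∀ i → PQ.src (i ↑ˡ n₂) ≡ inj₁ (P.src i)
  ⊗-src-↑ˡ i = cong (Sum.map P.src Q.src) (FinP.splitAt-↑ˡ n₁ i n₂)

  ⊗-src-↑ʳ : ∀ i → PQ.src (n₁ ↑ʳ i) ≡ inj₂ (Q.src i)
  ⊗-src-↑ʳ i = cong (Sum.map P.src Q.src) (FinP.splitAt-↑ʳ n₁ n₂ i)

  ⊗-tgt-↑ˡ : ∀ j → PQ.tgt (j ↑ˡ m₂) ≡ inj₁ (P.tgt j)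
  ⊗-tgt-↑ˡ j = cong (Sum.map P.tgt Q.tgt) (FinP.splitAt-↑ˡ m₁ j m₂)

  ⊗-tgt-↑ʳ : ∀ j → PQ.tgt (m₁ ↑ʳ j) ≡ inj₂ (Q.tgt j)
  ⊗-tgt-↑ʳ j = cong (Sum.map P.tgt Q.tgt) (FinP.splitAt-↑ʳ m₁ m₂ j)

  ⊗-isIposet : IsIposet P → IsIposet Q → IsIposet (P ⊗ Q)
  ⊗-isIposet IP IQ = record
    { irrefl  = λ { (inj₁ p) (lt₁ p<p) → IP.irrefl p p<p ; (inj₂ q) (lt₂ q<q) → IQ.irrefl q q<q }
    ; trans   = λ { (lt₁ p<p') (lt₁ p'<p'') → lt₁ (IP.trans p<p' p'<p'')
                  ; (lt₂ q<q') (lt₂ q'<q'') → lt₂ (IQ.trans q<q' q'<q'') }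
    ; src-inj = map∘splitAt-injective IP.src-inj IQ.src-inj
    ; tgt-inj = map∘splitAt-injective IP.tgt-inj IQ.tgt-inj
    ; src-min = src-Minimal
    ; tgt-max = tgt-Maximal }
    where
    module IP = IsIposet IP
    module IQ = IsIposet IQ
    src-Minimal : ∀ i → Minimal (P ⊗ Q) (PQ.src i)
    src-Minimal i y y<src with splitAt n₁ i
    src-Minimal i (inj₁ y) (lt₁ y<src) | inj₁ a = IP.src-min a y y<src
    src-Minimal i (inj₂ y) (lt₂ y<src) | inj₂ b = IQ.src-min b y y<src
    tgt-Maximal : ∀ j → Maximal (P ⊗ Q) (PQ.tgt j)
    tgt-Maximal j y tgt<y with splitAt m₁ j
    tgt-Maximal j (inj₁ y) (lt₁ tgt<y) | inj₁ a = IP.tgt-max a y tgt<y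
    tgt-Maximal j (inj₂ y) (lt₂ tgt<y) | inj₂ b = IQ.tgt-max b y tgt<y

  ⊗-minimalsAreSources : MinimalsAreSources P → MinimalsAreSources Q → MinimalsAreSources (P ⊗ Q)
  ⊗-minimalsAreSources P-min Q-min (inj₁ p) min =
    let (i , eq) = P-min p (λ p' p'<p → min (inj₁ p') (lt₁ p'<p))
    in i ↑ˡ n₂ , trans (⊗-src-↑ˡ i) (cong inj₁ eq)
  ⊗-minimalsAreSources P-min Q-min (inj₂ q) min =
    let (i , eq) = Q-min q (λ q' q'<q → min (inj₂ q') (lt₂ q'<q))
    in n₁ ↑ʳ i , trans (⊗-src-↑ʳ i) (cong inj₂ eq)

  ⊗-maximalsAreTargets : MaximalsAreTargets P → MaximalsAreTargets Q → MaximalsAreTargets (P ⊗ Q)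
  ⊗-maximalsAreTargets P-max Q-max (inj₁ p) max =
    let (j , eq) = P-max p (λ p' p<p' → max (inj₁ p') (lt₁ p<p'))
    in j ↑ˡ m₂ , trans (⊗-tgt-↑ˡ j) (cong inj₁ eq)
  ⊗-maximalsAreTargets P-max Q-max (inj₂ q) max =
    let (j , eq) = Q-max q (λ q' q<q' → max (inj₂ q') (lt₂ q<q'))
    in m₁ ↑ʳ j , trans (⊗-tgt-↑ʳ j) (cong inj₂ eq)

⊗-cong : ∀ {n₁ m₁ n₂ m₂ n₁' m₁' n₂' m₂'} {P₁ : Iposet n₁ m₁} {P₂ : Iposet n₂ m₂}
         {Q₁ : Iposet n₁' m₁'} {Q₂ : Iposet n₂' m₂'} → P₁ ≃ Q₁ → P₂ ≃ Q₂ → (P₁ ⊗ P₂) ≃ (Q₁ ⊗ Q₂)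
⊗-cong φ ψ = record
  { to        = Sum.map (to φ) (to ψ)
  ; from      = Sum.map (from φ) (from ψ)
  ; from-to   = λ { (inj₁ p) → cong inj₁ (from-to φ p) ; (inj₂ q) → cong inj₂ (from-to ψ q) }
  ; to-from   = λ { (inj₁ p) → cong inj₁ (to-from φ p) ; (inj₂ q) → cong inj₂ (to-from ψ q) }
  ; to-mono   = λ { (lt₁ p<p') → lt₁ (to-mono φ p<p')   ; (lt₂ q<q') → lt₂ (to-mono ψ q<q') }
  ; from-mono = λ { (lt₁ p<p') → lt₁ (from-mono φ p<p') ; (lt₂ q<q') → lt₂ (from-mono ψ q<q') } }

↑ˡ-cancel-< : ∀ {a} b {x x' : Fin a} → x ↑ˡ b Fin.< x' ↑ˡ b → x Fin.< x'
↑ˡ-cancel-< b {x} {x'} = subst₂ ℕ._<_ (FinP.toℕ-↑ˡ x b) (FinP.toℕ-↑ˡ x' b)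

↑ˡ-mono-< : ∀ {a} b {x x' : Fin a} → x Fin.< x' → x ↑ˡ b Fin.< x' ↑ˡ b
↑ˡ-mono-< b {x} {x'} = subst₂ ℕ._<_ (sym (FinP.toℕ-↑ˡ x b)) (sym (FinP.toℕ-↑ˡ x' b))

↑ʳ-cancel-< : ∀ a {b} {y y' : Fin b} → a ↑ʳ y Fin.< a ↑ʳ y' → y Fin.< y'
↑ʳ-cancel-< a {y = y} {y'} lt =
  ℕP.+-cancelˡ-< a (toℕ y) (toℕ y') (subst₂ ℕ._<_ (FinP.toℕ-↑ʳ a y) (FinP.toℕ-↑ʳ a y') lt)

↑ʳ-mono-< : ∀ a {b} {y y' : Fin b} → y Fin.< y' → a ↑ʳ y Fin.< a ↑ʳ y'
↑ʳ-mono-< a {y = y} {y'} lt =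
  subst₂ ℕ._<_ (sym (FinP.toℕ-↑ʳ a y)) (sym (FinP.toℕ-↑ʳ a y')) (ℕP.+-monoʳ-< a lt)

↑ˡ<↑ʳ : ∀ {a b} (x : Fin a) (y : Fin b) → x ↑ˡ b Fin.< a ↑ʳ y
↑ˡ<↑ʳ {a} {b} x y = subst₂ ℕ._<_ (sym (FinP.toℕ-↑ˡ x b)) (sym (FinP.toℕ-↑ʳ a y))
  (ℕP.<-≤-trans (FinP.toℕ<n x) (ℕP.m≤m+n a (toℕ y)))

SrcTgtMonotone : ∀ {n m} → Iposet n m → Set
SrcTgtMonotone P = ∀ i i' j j' → src i ≡ tgt j → src i' ≡ tgt j' → i Fin.< i' → j Fin.< j'
  where open Iposet P

SrcTgtMonotone-reflects : ∀ {n m} {P : Iposet n m} → IsIposet P → SrcTgtMonotone P →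
                          ∀ i i' j j' → Iposet.src P i ≡ Iposet.tgt P j → Iposet.src P i' ≡ Iposet.tgt P j' →
                          j Fin.< j' → i Fin.< i'
SrcTgtMonotone-reflects IP mono i i' j j' eq eq' j<j' with FinP.<-cmp i i'
... | tri< i<i' _ _ = i<i'
... | tri≈ _ refl _ = ⊥-elim (FinP.<-irrefl (IsIposet.tgt-inj IP j j' (trans (sym eq) eq')) j<j')
... | tri> _ _ i'<i = ⊥-elim (FinP.<-asym j<j' (mono i' i j' j eq' eq i'<i))

module _ {n₁ m₁ n₂ m₂} {P : Iposet n₁ m₁} {Q : Iposet n₂ m₂} where
  private
    module P = Iposet P
    module Q = Iposet Q
    module PQ = Iposet (P ⊗ Q)

  data SameSide (i : Fin (n₁ + n₂)) (j : Fin (m₁ + m₂)) : Set where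
    left  : ∀ {x y} → x ↑ˡ n₂ ≡ i → y ↑ˡ m₂ ≡ j → P.src x ≡ P.tgt y → SameSide i j
    right : ∀ {x y} → n₁ ↑ʳ x ≡ i → m₁ ↑ʳ y ≡ j → Q.src x ≡ Q.tgt y → SameSide i j

  sameSide : ∀ i j → PQ.src i ≡ PQ.tgt j → SameSide i j
  sameSide i j eq with splitAt n₁ i in eqᵢ | splitAt m₁ j in eqⱼ
  ... | inj₁ x | inj₁ y = left (FinP.splitAt⁻¹-↑ˡ eqᵢ) (FinP.splitAt⁻¹-↑ˡ eqⱼ) (SumP.inj₁-injective eq)
  ... | inj₂ x | inj₂ y = right (FinP.splitAt⁻¹-↑ʳ eqᵢ) (FinP.splitAt⁻¹-↑ʳ eqⱼ) (SumP.inj₂-injective eq)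

  ⊗-srcTgtMonotone : SrcTgtMonotone P → SrcTgtMonotone Q → SrcTgtMonotone (P ⊗ Q)
  ⊗-srcTgtMonotone P-mono Q-mono i i' j j' eq eq' i<i' with sameSide i j eq | sameSide i' j' eq'
  ... | left refl refl s | left refl refl s' =
    ↑ˡ-mono-< m₂ (P-mono _ _ _ _ s s' (↑ˡ-cancel-< n₂ i<i'))
  ... | left refl refl _  | right refl refl _ = ↑ˡ<↑ʳ _ _
  ... | right refl refl _ | left refl refl _  = ⊥-elim (FinP.<-asym i<i' (↑ˡ<↑ʳ _ _))
  ... | right refl refl s | right refl refl s' =
    ↑ʳ-mono-< m₁ (Q-mono _ _ _ _ s s' (↑ʳ-cancel-< n₁ i<i'))

∗-srcTgtMonotone : ∀ {n k m} {A : Iposet n k} {B : Iposet k m} →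
                   SrcTgtMonotone A → SrcTgtMonotone B → SrcTgtMonotone (A ∗ B)
∗-srcTgtMonotone {A = A} {B} A-mono B-mono i i' j j' eq eq' i<i' =
  let (c , c-tgt , c-src)    = G.inj₁≡ι₂ (trans eq (G.tgt≡ι₂ j))
      (c' , c'-tgt , c'-src) = G.inj₁≡ι₂ (trans eq' (G.tgt≡ι₂ j'))
  in B-mono c c' j j' c-src c'-src (A-mono i i' c c' (sym c-tgt) (sym c'-tgt) i<i')
  where module G = Gluing A B

Fin≤1-unique : ∀ {n} → n ℕ.≤ 1 → (i j : Fin n) → i ≡ j
Fin≤1-unique _         zero    zero     = refl
Fin≤1-unique (s≤s z≤n) zero    (suc ())
Fin≤1-unique (s≤s z≤n) (suc ()) _

point-isIposet : ∀ {n m} → n ℕ.≤ 1 → m ℕ.≤ 1 → IsIposet (point n m)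
point-isIposet n≤1 m≤1 = record
  { irrefl  = λ _ ()
  ; trans   = λ ()
  ; src-inj = λ i j _ → Fin≤1-unique n≤1 i j
  ; tgt-inj = λ i j _ → Fin≤1-unique m≤1 i j
  ; src-min = λ _ _ ()
  ; tgt-max = λ _ _ () }

⟦⟧-isIposet : ∀ {n m} (e : GPTerm n m) → IsIposet ⟦ e ⟧
⟦⟧-isIposet empty      = record
  { irrefl = λ () ; trans = λ {p} → ⊥-elim p ; src-inj = λ () ; tgt-inj = λ ()
  ; src-min = λ () ; tgt-max = λ () }
⟦⟧-isIposet pt₀₀       = point-isIposet z≤n z≤n
⟦⟧-isIposet pt₀₁       = point-isIposet z≤n ℕP.≤-refl
⟦⟧-isIposet pt₁₀       = point-isIposet ℕP.≤-refl z≤n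
⟦⟧-isIposet pt₁₁       = point-isIposet ℕP.≤-refl ℕP.≤-refl
⟦⟧-isIposet (par e f)  = ⊗-isIposet (⟦⟧-isIposet e) (⟦⟧-isIposet f)
⟦⟧-isIposet (glue e f) = ∗-isIposet (⟦⟧-isIposet e) (⟦⟧-isIposet f)

⟦⟧-srcTgtMonotone : ∀ {n m} (e : GPTerm n m) → SrcTgtMonotone ⟦ e ⟧
⟦⟧-srcTgtMonotone empty      = λ ()
⟦⟧-srcTgtMonotone pt₀₀       = λ ()
⟦⟧-srcTgtMonotone pt₀₁       = λ ()
⟦⟧-srcTgtMonotone pt₁₀       = λ _ _ ()
⟦⟧-srcTgtMonotone pt₁₁       = λ { zero zero _ _ _ _ () }
⟦⟧-srcTgtMonotone (par e f)  = ⊗-srcTgtMonotone {P = ⟦ e ⟧} {⟦ f ⟧} (⟦⟧-srcTgtMonotone e) (⟦⟧-srcTgtMonotone f)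
⟦⟧-srcTgtMonotone (glue e f) = ∗-srcTgtMonotone (⟦⟧-srcTgtMonotone e) (⟦⟧-srcTgtMonotone f)

Enumeration : Set → Set
Enumeration X = Σ (List X) (IsEnumeration (setoid X))

⟦⟧-enumeration : ∀ {n m} (e : GPTerm n m) → Enumeration (Iposet.Carrier ⟦ e ⟧)
⟦⟧-enumeration empty = [] , λ ()
⟦⟧-enumeration pt₀₀  = tt ∷ [] , λ _ → Any.here refl
⟦⟧-enumeration pt₀₁  = tt ∷ [] , λ _ → Any.here refl
⟦⟧-enumeration pt₁₀  = tt ∷ [] , λ _ → Any.here refl
⟦⟧-enumeration pt₁₁  = tt ∷ [] , λ _ → Any.here refl
⟦⟧-enumeration (par e f) =
  let (xs , xs-all) = ⟦⟧-enumeration e ; (ys , ys-all) = ⟦⟧-enumeration f in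
  map inj₁ xs ++ map inj₂ ys ,
  λ { (inj₁ x) → ∈-++⁺ˡ (∈-map⁺ inj₁ (xs-all x))
    ; (inj₂ y) → ∈-++⁺ʳ (map inj₁ xs) (∈-map⁺ inj₂ (ys-all y)) }
⟦⟧-enumeration (glue e f) with ⟦⟧-enumeration e | ⟦⟧-enumeration f
... | xs , xs-all | ys , ys-all = map inj₁ xs ++ map G.ι₂ ys , complete
  where
  module G = Gluing ⟦ e ⟧ ⟦ f ⟧
  complete : IsEnumeration (setoid G.Carrier) (map inj₁ xs ++ map G.ι₂ ys)
  complete x with G.inj₁-or-ι₂ x
  ... | inj₁ (a , refl) = ∈-++⁺ˡ (∈-map⁺ inj₁ (xs-all a))
  ... | inj₂ (b , refl) = ∈-++⁺ʳ (map inj₁ xs) (∈-map⁺ G.ι₂ (ys-all b))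

allOrCounterexample : ∀ {X : Set} {Q : X → Set} → Enumeration X → Decidable Q →
                      (∀ x → Q x) ⊎ ∃ λ x → ¬ Q x
allOrCounterexample (xs , xs-all) Q? =
  Sum.map (λ all x → All.lookup all (xs-all x)) Any.satisfied (All.decide (toSum ∘ Q?) xs)

data Thin : ℕ → ℕ → Set where
  done : Thin 0 0
  keep : ∀ {n k} → Thin n k → Thin (suc n) (suc k)
  skip : ∀ {n k} → Thin n k → Thin n (suc k)

embed : ∀ {n k} → Thin n k → Fin n → Fin k
embed (keep t) zero    = zero
embed (keep t) (suc i) = suc (embed t i)
embed (skip t) i       = suc (embed t i)

skips : ∀ k → Thin 0 k
skips zero    = done
skips (suc k) = skip (skips k)

_++ᵗ_ : ∀ {n₁ k₁ n₂ k₂} → Thin n₁ k₁ → Thin n₂ k₂ → Thin (n₁ + n₂) (k₁ + k₂)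
done   ++ᵗ u = u
keep t ++ᵗ u = keep (t ++ᵗ u)
skip t ++ᵗ u = skip (t ++ᵗ u)

splitAt-embed-++ : ∀ {n₁ k₁ n₂ k₂} (t : Thin n₁ k₁) (u : Thin n₂ k₂) i →
                   splitAt k₁ (embed (t ++ᵗ u) i) ≡ Sum.map (embed t) (embed u) (splitAt n₁ i)
splitAt-embed-++ done     u i    = refl
splitAt-embed-++ (keep t) u zero = refl
splitAt-embed-++ {suc n₁} (keep t) u (suc i) rewrite splitAt-embed-++ t u i with splitAt n₁ i
... | inj₁ _ = refl
... | inj₂ _ = refl
splitAt-embed-++ {n₁} (skip t) u i rewrite splitAt-embed-++ t u i with splitAt n₁ i
... | inj₁ _ = refl
... | inj₂ _ = refl

_∘ᵗ_ : ∀ {n k l} → Thin k l → Thin n k → Thin n l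
done   ∘ᵗ done   = done
keep u ∘ᵗ keep t = keep (u ∘ᵗ t)
keep u ∘ᵗ skip t = skip (u ∘ᵗ t)
skip u ∘ᵗ t      = skip (u ∘ᵗ t)

embed-∘ᵗ : ∀ {n k l} (u : Thin k l) (t : Thin n k) → embed (u ∘ᵗ t) ≗ embed u ∘ embed t
embed-∘ᵗ done     done     ()
embed-∘ᵗ (keep u) (keep t) zero    = refl
embed-∘ᵗ (keep u) (keep t) (suc i) = cong suc (embed-∘ᵗ u t i)
embed-∘ᵗ (keep u) (skip t) i       = cong suc (embed-∘ᵗ u t i)
embed-∘ᵗ (skip u) t        i       = cong suc (embed-∘ᵗ u t i)

StrictlyMonotone : ∀ {n k} → (Fin n → Fin k) → Set
StrictlyMonotone f = ∀ {i i'} → i Fin.< i' → f i Fin.< f i'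

predecessor : ∀ {k} (x : Fin (suc k)) → x ≢ zero → ∃ λ y → suc y ≡ x
predecessor zero    x≢0 = ⊥-elim (x≢0 refl)
predecessor (suc y) _   = y , refl

factor-suc : ∀ {n k} (f : Fin n → Fin (suc k)) → (∀ i → f i ≢ zero) → StrictlyMonotone f →
           Σ (Fin n → Fin k) λ g → (suc ∘ g ≗ f) × StrictlyMonotone g
factor-suc {n} {k} f f≢0 f-mono = g , g-suc , g-mono
  where
  g : Fin n → Fin k
  g i = proj₁ (predecessor (f i) (f≢0 i))
  g-suc : suc ∘ g ≗ f
  g-suc i = proj₂ (predecessor (f i) (f≢0 i))
  g-mono : StrictlyMonotone g
  g-mono i<i' = ℕ.s≤s⁻¹ (subst₂ Fin._<_ (sym (g-suc _)) (sym (g-suc _)) (f-mono i<i'))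

thinning : ∀ {n k} (f : Fin n → Fin k) → StrictlyMonotone f → Σ (Thin n k) λ t → embed t ≗ f
thinning {zero}  {k}    f _ = skips k , λ ()
thinning {suc n} {zero} f _ with f zero
... | ()
thinning {suc n} {suc k} f f-mono with f zero in f0≡
... | zero =
  let (g , g-suc , g-mono) = factor-suc (f ∘ suc) f∘suc≢0 (λ i<i' → f-mono (ℕ.s<s i<i'))
      (t , t≗g) = thinning g g-mono
  in keep t , λ { zero → sym f0≡ ; (suc i) → trans (cong suc (t≗g i)) (g-suc i) }
  where
  f∘suc≢0 : ∀ i → f (suc i) ≢ zero
  f∘suc≢0 i eq = ℕP.<-irrefl refl (subst₂ Fin._<_ f0≡ eq (f-mono {zero} {suc i} ℕ.z<s))
... | suc y =
  let (g , g-suc , g-mono) = factor-suc f f≢0 f-mono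
      (t , t≗g) = thinning g g-mono
  in skip t , λ i → trans (cong suc (t≗g i)) (g-suc i)
  where
  f≢0 : ∀ i → f i ≢ zero
  f≢0 zero    eq = FinP.0≢1+n (trans (sym eq) f0≡)
  f≢0 (suc i) eq = ℕP.n≮0 (subst (f zero Fin.<_) eq (f-mono {zero} {suc i} ℕ.z<s))

starter : ∀ {n k} → Thin n k → GPTerm n k
starter done     = empty
starter (keep t) = par pt₁₁ (starter t)
starter (skip t) = par pt₀₁ (starter t)

terminator : ∀ {n k} → Thin n k → GPTerm k n
terminator done     = empty
terminator (keep t) = par pt₁₁ (terminator t)
terminator (skip t) = par pt₁₀ (terminator t)

starter-discrete : ∀ {n k} (t : Thin n k) → Discrete ⟦ starter t ⟧
starter-discrete done     ()
starter-discrete (keep t) (inj₂ p) (inj₂ q) (lt₂ p<q) = starter-discrete t p q p<q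
starter-discrete (skip t) (inj₂ p) (inj₂ q) (lt₂ p<q) = starter-discrete t p q p<q

starter-tgt-surjective : ∀ {n k} (t : Thin n k) p → IsTarget ⟦ starter t ⟧ p
starter-tgt-surjective done     ()
starter-tgt-surjective (keep t) (inj₁ tt) = zero , refl
starter-tgt-surjective (keep t) (inj₂ p)  = let (j , eq) = starter-tgt-surjective t p in suc j , cong inj₂ eq
starter-tgt-surjective (skip t) (inj₁ tt) = zero , refl
starter-tgt-surjective (skip t) (inj₂ p)  = let (j , eq) = starter-tgt-surjective t p in suc j , cong inj₂ eq

starter-src : ∀ {n k} (t : Thin n k) i →
              Iposet.src ⟦ starter t ⟧ i ≡ Iposet.tgt ⟦ starter t ⟧ (embed t i)
starter-src done     ()
starter-src (keep t) zero    = refl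
starter-src (keep t) (suc i) = cong inj₂ (starter-src t i)
starter-src (skip t) i       = cong inj₂ (starter-src t i)

terminator-discrete : ∀ {n k} (t : Thin n k) → Discrete ⟦ terminator t ⟧
terminator-discrete done     ()
terminator-discrete (keep t) (inj₂ p) (inj₂ q) (lt₂ p<q) = terminator-discrete t p q p<q
terminator-discrete (skip t) (inj₂ p) (inj₂ q) (lt₂ p<q) = terminator-discrete t p q p<q

terminator-src-surjective : ∀ {n k} (t : Thin n k) p → IsSource ⟦ terminator t ⟧ p
terminator-src-surjective done     ()
terminator-src-surjective (keep t) (inj₁ tt) = zero , refl
terminator-src-surjective (keep t) (inj₂ p)  = let (i , eq) = terminator-src-surjective t p in suc i , cong inj₂ eq
terminator-src-surjective (skip t) (inj₁ tt) = zero , refl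
terminator-src-surjective (skip t) (inj₂ p)  = let (i , eq) = terminator-src-surjective t p in suc i , cong inj₂ eq

terminator-tgt : ∀ {n k} (t : Thin n k) j →
                 Iposet.tgt ⟦ terminator t ⟧ j ≡ Iposet.src ⟦ terminator t ⟧ (embed t j)
terminator-tgt done     ()
terminator-tgt (keep t) zero    = refl
terminator-tgt (keep t) (suc j) = cong inj₂ (terminator-tgt t j)
terminator-tgt (skip t) j       = cong inj₂ (terminator-tgt t j)

record WinkowskiCore {n m} (e : GPTerm n m) : Set where
  field
    k l           : ℕ
    core          : GPTerm k l
    core-minimals : MinimalsAreSources ⟦ core ⟧
    core-maximals : MaximalsAreTargets ⟦ core ⟧
    srcThin       : Thin n k
    tgtThin       : Thin m l
    iso           : ⟦ e ⟧ ≃ ⟦ core ⟧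
    iso-src       : ∀ i → to iso (Iposet.src ⟦ e ⟧ i) ≡ Iposet.src ⟦ core ⟧ (embed srcThin i)
    iso-tgt       : ∀ j → to iso (Iposet.tgt ⟦ e ⟧ j) ≡ Iposet.tgt ⟦ core ⟧ (embed tgtThin j)

module Decomposition {n m} {e : GPTerm n m} (C : WinkowskiCore e) where
  open WinkowskiCore C
  private
    module E = Iposet ⟦ e ⟧
    module W = Iposet ⟦ core ⟧

  S : Iposet n k
  S = ⟦ starter srcThin ⟧

  W : Iposet k l
  W = ⟦ core ⟧

  T : Iposet l m
  T = ⟦ terminator tgtThin ⟧

  S-isIposet : IsIposet S
  S-isIposet = ⟦⟧-isIposet (starter srcThin)

  W-isIposet : IsIposet W
  W-isIposet = ⟦⟧-isIposet core

  T-isIposet : IsIposet T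
  T-isIposet = ⟦⟧-isIposet (terminator tgtThin)

  private
    module SW   = Gluing S W
    module SWp  = SW.Properties S-isIposet W-isIposet
    module WTp  = Gluing.Properties W T W-isIposet T-isIposet
    module SWTp = Gluing.Properties (S ∗ W) T (∗-isIposet S-isIposet W-isIposet) T-isIposet

    S∗W≃W : (S ∗ W) ≃ W
    S∗W≃W = ∗-unitˡ S-isIposet W-isIposet (starter-tgt-surjective srcThin)

    W∗T≃W : (W ∗ T) ≃ W
    W∗T≃W = ∗-unitʳ W-isIposet T-isIposet (terminator-src-surjective tgtThin)

  S∗W-maximals : MaximalsAreTargets (S ∗ W)
  S∗W-maximals = MaximalsAreTargets-≃ S∗W≃W
    (∗-unitˡ-tgt S-isIposet W-isIposet (starter-tgt-surjective srcThin)) core-maximals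

  W∗T-minimals : MinimalsAreSources (W ∗ T)
  W∗T-minimals = MinimalsAreSources-≃ W∗T≃W
    (∗-unitʳ-src W-isIposet T-isIposet (terminator-src-surjective tgtThin)) core-minimals

  toS∗W : ⟦ e ⟧ ≃ (S ∗ W)
  toS∗W = ≃-trans iso (≃-sym S∗W≃W)

  toS∗W-src : PreservesSources toS∗W
  toS∗W-src i = begin
    SW.ι₂ (to iso (E.src i))                  ≡⟨ cong SW.ι₂ (iso-src i) ⟩
    SW.ι₂ (W.src (embed srcThin i))           ≡⟨ SWp.ι₂-src (embed srcThin i) ⟩
    inj₁ (Iposet.tgt S (embed srcThin i))     ≡⟨ cong inj₁ (sym (starter-src srcThin i)) ⟩
    inj₁ (Iposet.src S i)                     ∎
    where open ≡-Reasoning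

  toS∗W-tgt : ∀ j → to toS∗W (E.tgt j) ≡ SW.ι₂ (W.tgt (embed tgtThin j))
  toS∗W-tgt j = cong SW.ι₂ (iso-tgt j)

  toW∗T : ⟦ e ⟧ ≃ (W ∗ T)
  toW∗T = ≃-trans iso (≃-sym W∗T≃W)

  toW∗T-src : ∀ i → to toW∗T (E.src i) ≡ inj₁ (W.src (embed srcThin i))
  toW∗T-src i = cong inj₁ (iso-src i)

  toW∗T-tgt : PreservesTargets toW∗T
  toW∗T-tgt j = trans (cong inj₁ (iso-tgt j)) (sym (WTp.tgt≡inj₁ (sym (terminator-tgt tgtThin j))))

  toS∗W∗T : ⟦ e ⟧ ≃ ((S ∗ W) ∗ T)
  toS∗W∗T = ≃-trans toS∗W (≃-sym (∗-unitʳ (∗-isIposet S-isIposet W-isIposet) T-isIposet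
                                    (terminator-src-surjective tgtThin)))

  toS∗W∗T-src : PreservesSources toS∗W∗T
  toS∗W∗T-src i = cong inj₁ (toS∗W-src i)

  toS∗W∗T-tgt : PreservesTargets toS∗W∗T
  toS∗W∗T-tgt j = begin
    inj₁ (to toS∗W (E.tgt j))                     ≡⟨ cong inj₁ (toS∗W-tgt j) ⟩
    inj₁ (SW.ι₂ (W.tgt (embed tgtThin j)))        ≡⟨ cong inj₁ (sym (SW.tgt≡ι₂ (embed tgtThin j))) ⟩
    inj₁ (SW.tgt (embed tgtThin j))               ≡⟨ sym (SWTp.tgt≡inj₁ (sym (terminator-tgt tgtThin j))) ⟩
    Iposet.tgt ((S ∗ W) ∗ T) j                    ∎
    where open ≡-Reasoning

⊗-core : ∀ {n₁ m₁ n₂ m₂} {e₁ : GPTerm n₁ m₁} {e₂ : GPTerm n₂ m₂} →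
         WinkowskiCore e₁ → WinkowskiCore e₂ → WinkowskiCore (par e₁ e₂)
⊗-core {n₁} {m₁} C₁ C₂ = record
  { k             = C₁.k + C₂.k
  ; l             = C₁.l + C₂.l
  ; core          = par C₁.core C₂.core
  ; core-minimals = ⊗-minimalsAreSources {P = ⟦ C₁.core ⟧} {⟦ C₂.core ⟧} C₁.core-minimals C₂.core-minimals
  ; core-maximals = ⊗-maximalsAreTargets {P = ⟦ C₁.core ⟧} {⟦ C₂.core ⟧} C₁.core-maximals C₂.core-maximals
  ; srcThin       = C₁.srcThin ++ᵗ C₂.srcThin
  ; tgtThin       = C₁.tgtThin ++ᵗ C₂.tgtThin
  ; iso           = ⊗-cong C₁.iso C₂.iso
  ; iso-src       = λ i → trans (map-square C₁.iso-src C₂.iso-src (splitAt n₁ i))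
                            (cong (Sum.map W₁.src W₂.src) (sym (splitAt-embed-++ C₁.srcThin C₂.srcThin i)))
  ; iso-tgt       = λ j → trans (map-square C₁.iso-tgt C₂.iso-tgt (splitAt m₁ j))
                            (cong (Sum.map W₁.tgt W₂.tgt) (sym (splitAt-embed-++ C₁.tgtThin C₂.tgtThin j))) }
  where
  module C₁ = WinkowskiCore C₁
  module C₂ = WinkowskiCore C₂
  module W₁ = Iposet ⟦ C₁.core ⟧
  module W₂ = Iposet ⟦ C₂.core ⟧

∗-core-allTargets : ∀ {n k m} (e₁ : GPTerm n k) {e₂ : GPTerm k m} →
                    (∀ p → IsTarget ⟦ e₁ ⟧ p) → WinkowskiCore e₂ → WinkowskiCore (glue e₁ e₂)
∗-core-allTargets {n} {k} e₁ {e₂} e₁-tgt C = record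
  { k             = C.k
  ; l             = C.l
  ; core          = C.core
  ; core-minimals = C.core-minimals
  ; core-maximals = C.core-maximals
  ; srcThin       = C.srcThin ∘ᵗ θ
  ; tgtThin       = C.tgtThin
  ; iso           = ≃-trans unit C.iso
  ; iso-src       = iso-src
  ; iso-tgt       = λ j → trans (cong (to C.iso) (∗-unitˡ-tgt IP₁ IP₂ e₁-tgt j)) (C.iso-tgt j) }
  where
  module C = WinkowskiCore C
  module P₁ = Iposet ⟦ e₁ ⟧
  module W = Iposet ⟦ C.core ⟧
  IP₁ : IsIposet ⟦ e₁ ⟧
  IP₁ = ⟦⟧-isIposet e₁
  IP₂ : IsIposet ⟦ e₂ ⟧
  IP₂ = ⟦⟧-isIposet e₂
  unit : (⟦ e₁ ⟧ ∗ ⟦ e₂ ⟧) ≃ ⟦ e₂ ⟧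
  unit = ∗-unitˡ IP₁ IP₂ e₁-tgt
  matching : Fin n → Fin k
  matching i = proj₁ (e₁-tgt (P₁.src i))
  matching-tgt : ∀ i → P₁.tgt (matching i) ≡ P₁.src i
  matching-tgt i = proj₂ (e₁-tgt (P₁.src i))
  matching-mono : StrictlyMonotone matching
  matching-mono = ⟦⟧-srcTgtMonotone e₁ _ _ _ _ (sym (matching-tgt _)) (sym (matching-tgt _))
  θ : Thin n k
  θ = proj₁ (thinning matching matching-mono)
  θ≗matching : embed θ ≗ matching
  θ≗matching = proj₂ (thinning matching matching-mono)
  iso-src : ∀ i → to C.iso (to unit (Iposet.src ⟦ glue e₁ e₂ ⟧ i)) ≡ W.src (embed (C.srcThin ∘ᵗ θ) i)
  iso-src i = begin
    to C.iso (to unit (Iposet.src ⟦ glue e₁ e₂ ⟧ i))  ≡⟨ cong (to C.iso) (∗-unitˡ-src IP₁ IP₂ e₁-tgt i _ (matching-tgt i)) ⟩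
    to C.iso (Iposet.src ⟦ e₂ ⟧ (matching i))         ≡⟨ C.iso-src (matching i) ⟩
    W.src (embed C.srcThin (matching i))              ≡⟨ cong (W.src ∘ embed C.srcThin) (sym (θ≗matching i)) ⟩
    W.src (embed C.srcThin (embed θ i))               ≡⟨ cong W.src (sym (embed-∘ᵗ C.srcThin θ i)) ⟩
    W.src (embed (C.srcThin ∘ᵗ θ) i)                  ∎
    where open ≡-Reasoning

∗-core-allSources : ∀ {n k m} {e₁ : GPTerm n k} (e₂ : GPTerm k m) →
                    (∀ p → IsSource ⟦ e₂ ⟧ p) → WinkowskiCore e₁ → WinkowskiCore (glue e₁ e₂)
∗-core-allSources {n} {k} {m} {e₁} e₂ e₂-src C = record
  { k             = C.k
  ; l             = C.l
  ; core          = C.core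
  ; core-minimals = C.core-minimals
  ; core-maximals = C.core-maximals
  ; srcThin       = C.srcThin
  ; tgtThin       = C.tgtThin ∘ᵗ θ
  ; iso           = ≃-trans unit C.iso
  ; iso-src       = C.iso-src
  ; iso-tgt       = iso-tgt }
  where
  module C = WinkowskiCore C
  module P₂ = Iposet ⟦ e₂ ⟧
  module W = Iposet ⟦ C.core ⟧
  IP₁ : IsIposet ⟦ e₁ ⟧
  IP₁ = ⟦⟧-isIposet e₁
  IP₂ : IsIposet ⟦ e₂ ⟧
  IP₂ = ⟦⟧-isIposet e₂
  unit : (⟦ e₁ ⟧ ∗ ⟦ e₂ ⟧) ≃ ⟦ e₁ ⟧
  unit = ∗-unitʳ IP₁ IP₂ e₂-src
  matching : Fin m → Fin k
  matching j = proj₁ (e₂-src (P₂.tgt j))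
  matching-src : ∀ j → P₂.src (matching j) ≡ P₂.tgt j
  matching-src j = proj₂ (e₂-src (P₂.tgt j))
  matching-mono : StrictlyMonotone matching
  matching-mono = SrcTgtMonotone-reflects IP₂ (⟦⟧-srcTgtMonotone e₂) _ _ _ _ (matching-src _) (matching-src _)
  θ : Thin m k
  θ = proj₁ (thinning matching matching-mono)
  θ≗matching : embed θ ≗ matching
  θ≗matching = proj₂ (thinning matching matching-mono)
  iso-tgt : ∀ j → to C.iso (to unit (Iposet.tgt ⟦ glue e₁ e₂ ⟧ j)) ≡ W.tgt (embed (C.tgtThin ∘ᵗ θ) j)
  iso-tgt j = begin
    to C.iso (to unit (Iposet.tgt ⟦ glue e₁ e₂ ⟧ j))  ≡⟨ cong (to C.iso) (∗-unitʳ-tgt IP₁ IP₂ e₂-src j _ (matching-src j)) ⟩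
    to C.iso (Iposet.tgt ⟦ e₁ ⟧ (matching j))         ≡⟨ C.iso-tgt (matching j) ⟩
    W.tgt (embed C.tgtThin (matching j))              ≡⟨ cong (W.tgt ∘ embed C.tgtThin) (sym (θ≗matching j)) ⟩
    W.tgt (embed C.tgtThin (embed θ j))               ≡⟨ cong W.tgt (sym (embed-∘ᵗ C.tgtThin θ j)) ⟩
    W.tgt (embed (C.tgtThin ∘ᵗ θ) j)                  ∎
    where open ≡-Reasoning

∗-core-mixed : ∀ {n k m} {e₁ : GPTerm n k} {e₂ : GPTerm k m} → WinkowskiCore e₁ → WinkowskiCore e₂ →
               ∀ {u v} → ¬ IsTarget ⟦ e₁ ⟧ u → ¬ IsSource ⟦ e₂ ⟧ v → WinkowskiCore (glue e₁ e₂)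
∗-core-mixed {e₁ = e₁} {e₂} C₁ C₂ u∉tgt v∉src = record
  { k             = C₁.k
  ; l             = C₂.l
  ; core          = glue (glue C₁.core (terminator C₁.tgtThin)) (glue (starter C₂.srcThin) C₂.core)
  ; core-minimals = XYp.minimalsAreSources (u∉tgt ∘ IsTarget-to⁻ D₁.toW∗T D₁.toW∗T-tgt) D₁.W∗T-minimals
  ; core-maximals = XYp.maximalsAreTargets (v∉src ∘ IsSource-to⁻ D₂.toS∗W D₂.toS∗W-src) D₂.S∗W-maximals
  ; srcThin       = C₁.srcThin
  ; tgtThin       = C₂.tgtThin
  ; iso           = ∗-cong IP₁ IX IP₂ IY D₁.toW∗T D₂.toS∗W D₁.toW∗T-tgt D₂.toS∗W-src
  ; iso-src       = λ i → cong inj₁ (D₁.toW∗T-src i)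
  ; iso-tgt       = iso-tgt }
  where
  module C₁ = WinkowskiCore C₁
  module C₂ = WinkowskiCore C₂
  module D₁ = Decomposition C₁
  module D₂ = Decomposition C₂
  IP₁ : IsIposet ⟦ e₁ ⟧
  IP₁ = ⟦⟧-isIposet e₁
  IP₂ : IsIposet ⟦ e₂ ⟧
  IP₂ = ⟦⟧-isIposet e₂
  IX : IsIposet (D₁.W ∗ D₁.T)
  IX = ∗-isIposet D₁.W-isIposet D₁.T-isIposet
  IY : IsIposet (D₂.S ∗ D₂.W)
  IY = ∗-isIposet D₂.S-isIposet D₂.W-isIposet
  module G   = Gluing ⟦ e₁ ⟧ ⟦ e₂ ⟧
  module Y   = Gluing D₂.S D₂.W
  module XY  = Gluing (D₁.W ∗ D₁.T) (D₂.S ∗ D₂.W)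
  module XYp = XY.Properties IX IY
  iso-tgt : ∀ j → ∗-map D₁.toW∗T D₂.toS∗W (G.tgt j) ≡ XY.tgt (embed C₂.tgtThin j)
  iso-tgt j = begin
    ∗-map D₁.toW∗T D₂.toS∗W (G.tgt j)                        ≡⟨ cong (∗-map D₁.toW∗T D₂.toS∗W) (G.tgt≡ι₂ j) ⟩
    ∗-map D₁.toW∗T D₂.toS∗W (G.ι₂ (Iposet.tgt ⟦ e₂ ⟧ j))    ≡⟨ ∗-map-ι₂ IP₁ IX IP₂ IY D₁.toW∗T D₂.toS∗W
                                                                   D₁.toW∗T-tgt D₂.toS∗W-src _ ⟩
    XY.ι₂ (to D₂.toS∗W (Iposet.tgt ⟦ e₂ ⟧ j))                ≡⟨ cong XY.ι₂ (D₂.toS∗W-tgt j) ⟩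
    XY.ι₂ (Y.ι₂ (Iposet.tgt D₂.W (embed C₂.tgtThin j)))      ≡⟨ cong XY.ι₂ (sym (Y.tgt≡ι₂ _)) ⟩
    XY.ι₂ (Y.tgt (embed C₂.tgtThin j))                       ≡⟨ sym (XY.tgt≡ι₂ _) ⟩
    XY.tgt (embed C₂.tgtThin j)                              ∎
    where open ≡-Reasoning

∗-core : ∀ {n k m} (e₁ : GPTerm n k) (e₂ : GPTerm k m) →
         WinkowskiCore e₁ → WinkowskiCore e₂ → WinkowskiCore (glue e₁ e₂)
∗-core e₁ e₂ C₁ C₂ with allOrCounterexample (⟦⟧-enumeration e₁) (isTarget? ⟦ e₁ ⟧)
... | inj₁ e₁-tgt = ∗-core-allTargets e₁ e₁-tgt C₂
... | inj₂ (_ , u∉tgt) with allOrCounterexample (⟦⟧-enumeration e₂) (isSource? ⟦ e₂ ⟧)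
...   | inj₁ e₂-src      = ∗-core-allSources e₂ e₂-src C₁
...   | inj₂ (_ , v∉src) = ∗-core-mixed C₁ C₂ u∉tgt v∉src

point-≃ : ∀ {n m n' m'} → point n m ≃ point n' m'
point-≃ = record
  { to = id ; from = id ; from-to = λ _ → refl ; to-from = λ _ → refl
  ; to-mono = id ; from-mono = id }

pt₁₁-minimals : MinimalsAreSources ⟦ pt₁₁ ⟧
pt₁₁-minimals _ _ = zero , refl

pt₁₁-maximals : MaximalsAreTargets ⟦ pt₁₁ ⟧
pt₁₁-maximals _ _ = zero , refl

winkowskiCore : ∀ {n m} (e : GPTerm n m) → WinkowskiCore e
winkowskiCore empty = record
  { k = 0 ; l = 0 ; core = empty ; core-minimals = λ () ; core-maximals = λ ()
  ; srcThin = done ; tgtThin = done ; iso = ≃-refl ; iso-src = λ () ; iso-tgt = λ () }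
winkowskiCore pt₀₀ = record
  { k = 1 ; l = 1 ; core = pt₁₁ ; core-minimals = pt₁₁-minimals ; core-maximals = pt₁₁-maximals
  ; srcThin = skip done ; tgtThin = skip done ; iso = point-≃ ; iso-src = λ () ; iso-tgt = λ () }
winkowskiCore pt₀₁ = record
  { k = 1 ; l = 1 ; core = pt₁₁ ; core-minimals = pt₁₁-minimals ; core-maximals = pt₁₁-maximals
  ; srcThin = skip done ; tgtThin = keep done ; iso = point-≃ ; iso-src = λ () ; iso-tgt = λ _ → refl }
winkowskiCore pt₁₀ = record
  { k = 1 ; l = 1 ; core = pt₁₁ ; core-minimals = pt₁₁-minimals ; core-maximals = pt₁₁-maximals
  ; srcThin = keep done ; tgtThin = skip done ; iso = point-≃ ; iso-src = λ _ → refl ; iso-tgt = λ () }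
winkowskiCore pt₁₁ = record
  { k = 1 ; l = 1 ; core = pt₁₁ ; core-minimals = pt₁₁-minimals ; core-maximals = pt₁₁-maximals
  ; srcThin = keep done ; tgtThin = keep done ; iso = ≃-refl ; iso-src = λ _ → refl ; iso-tgt = λ _ → refl }
winkowskiCore (par e₁ e₂)  = ⊗-core (winkowskiCore e₁) (winkowskiCore e₂)
winkowskiCore (glue e₁ e₂) = ∗-core e₁ e₂ (winkowskiCore e₁) (winkowskiCore e₂)

lemma6 : ∀ {n m} (P : Iposet n m) → IsIposet P → GluingParallel P →
    Σ ℕ λ k → Σ ℕ λ l →
    Σ (Iposet n k) λ S → Σ (Iposet k l) λ W → Σ (Iposet l m) λ T →
      IsIposet S × IsIposet W × IsIposet T
      × Starter S × Winkowski W × Terminator T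
      × GluingParallel S × GluingParallel W × GluingParallel T
      × (P ≅ ((S ∗ W) ∗ T))
-- The hypothesis IsIposet P is unused: every ⟦ e ⟧ is an iposet (⟦⟧-isIposet).
lemma6 P _ (e , P≅e) =
  k , l , S , W , T , S-isIposet , W-isIposet , T-isIposet ,
  (starter-discrete srcThin , starter-tgt-surjective srcThin) ,
  winkowski W-isIposet core-minimals core-maximals ,
  (terminator-discrete tgtThin , terminator-src-surjective tgtThin) ,
  (starter srcThin , ≅-refl) , (core , ≅-refl) , (terminator tgtThin , ≅-refl) ,
  ≅-trans P≅e (≃⇒≅ toS∗W∗T toS∗W∗T-src toS∗W∗T-tgt)
  where
  open WinkowskiCore (winkowskiCore e)
  open Decomposition (winkowskiCore e)
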